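{- Let $l\ge1$, $i\in\{0,\ldots,l+1\}$ and $j_1,j_2\in\{0,\ldots,2^l-1\}$ with $\delta:=\delta(j_1,j_2)>0$. Then in $G_l$, $\mathcal{V}_\delta(v_i(j_1))=\mathcal{V}_\delta(v_i(j_2))$.
   Context: For $j_1,j_2\in\{0,\ldots,2^l-1\}$, $\delta(j_1,j_2)$ is the largest $\delta\in\{0,\ldots,l\}$ with $j_1\equiv j_2\pmod{2^\delta}$. Let $b_k(j)=\lfloor j/2^k\rfloor\bmod2$ and $\oplus$ bitwise xor. Define $\pi_0(j)=j$ and for $i\ge1$, $\pi_i(j)=(j-2^ib_i(j)-2^{i-1}b_{i-1}(j))+2^ib_{i-1}(j)+2^{i-1}b_i(j)$. The port-labeled graph $G_l$ (every node of degree $k$ has its incident edges labeled bijectively by $\{1,\dots,k\}$; $\lambda(u,v)$ is the port at $u$ of edge $\{u,v\}$) has nodes $v_i(j)$, $i\in\{0,\ldots,l+1\}$, $j\in\{0,\ldots,2^l-1\}$, and edges: (1) for each $j$, $\{v_0(j),v_0(j\oplus1)\}$ with $\lambda(v_0(j),v_0(j\oplus1))=1+((j+1)\bmod2)$; (2) for each $j$ and $p\in\{1,\ldots,2^l-1\}$, $\{v_{l+1}(j),v_{l+1}((j+p)\bmod2^l)\}$ with $\lambda(v_{l+1}(j),v_{l+1}((j+p)\bmod2^l))=p$; (3) for each $j$ and $i\in\{0,\ldots,l\}$, $\{v_{l+1}(j),v_i(j)\}$ with $\lambda(v_{l+1}(j),v_i(j))=2^l+i$, $\lambda(v_i(j),v_{l+1}(j))=1$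 for $i>0$ and $\lambda(v_0(j),v_{l+1}(j))=1+(j\bmod2)$; (4) for each $j$ and $i\in\{0,\ldots,l-1\}$, $\{v_i(j),v_{i+1}(\pi_i(j))\}$ with $\lambda(v_i(j),v_{i+1}(\pi_i(j)))=3$, $\lambda(v_{i+1}(\pi_i(j)),v_i(j))=2$. The truncated view $\mathcal{V}_t(v)$ is the rooted port-labeled tree defined recursively: $\mathcal{V}_0(v)$ is a single root $x_0$; $\mathcal{V}_{t+1}(v)$ has root $x_0$ with one child $x_i$ per neighbor $v_i$ of $v$, edge $\{x_0,x_i\}$ carrying port $\lambda(v,v_i)$ at $x_0$ and $\lambda(v_i,v)$ at $x_i$, and subtree at $x_i$ equal to $\mathcal{V}_t(v_i)$. -}

module Defs where

open import Data.Nat using (ℕ; zero; suc; _+_; _*_; _∸_; _^_; _≡ᵇ_; _<ᵇ_; NonZero)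
open import Data.Nat.DivMod using (_/_; _%_)
open import Data.Nat.Properties using (m^n≢0)
open import Data.Bool using (Bool; true; false; if_then_else_)
open import Data.List using (List; []; map; upTo)
open import Data.Product using (_×_; _,_; proj₁; proj₂)

pow2 : ℕ → ℕ
pow2 k = 2 ^ k

b : ℕ → ℕ → ℕ
b k j = _/_ j (2 ^ k) {{m^n≢0 2 k}} % 2

-- j ⊕ 1 (bitwise xor with 1): flip bit 0
xor1 : ℕ → ℕ
xor1 j = (j ∸ b 0 j) + (1 ∸ b 0 j)

π : ℕ → ℕ → ℕ
π zero j = j
π (suc i') j =
  let i = suc i' in
  ((j ∸ 2 ^ i * b i j) ∸ 2 ^ i' * b i' j) + 2 ^ i * b i' j + 2 ^ i' * b i j

deltaUpTo : ℕ → ℕ → ℕ → ℕ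
deltaUpTo zero j₁ j₂ = zero
deltaUpTo (suc d) j₁ j₂ =
  if (_%_ j₁ (2 ^ suc d) {{m^n≢0 2 (suc d)}}) ≡ᵇ (_%_ j₂ (2 ^ suc d) {{m^n≢0 2 (suc d)}})
  then suc d else deltaUpTo d j₁ j₂

δ : ℕ → ℕ → ℕ → ℕ
δ l j₁ j₂ = deltaUpTo l j₁ j₂

-- Node v_i(j) is represented by the pair
-- of naturals i, j (meaningful for i ≤ l+1, j < 2^l).
-- deg l i j : degree of v_i(j)
-- nbr l i j p = (i' , j' , q) : the edge at port p of v_i(j) leads to
--   v_{i'}(j'), and its port at v_{i'}(j') is q.
-- These are read off the edge list (1)-(4) of the paper.

deg : ℕ → ℕ → ℕ → ℕ
deg l i j =
  if i ≡ᵇ suc l then 2 ^ l + l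
  else if i ≡ᵇ l then 2
  else if i <ᵇ l then 3
  else 0

nbr : ℕ → ℕ → ℕ → ℕ → ℕ × ℕ × ℕ
nbr l i j p =
  if i ≡ᵇ suc l then
    -- ports 1..2^l-1: edges (2); ports 2^l+i': edges (3)
    (if p <ᵇ 2 ^ l
     then (suc l , _%_ (j + p) (2 ^ l) {{m^n≢0 2 l}} , 2 ^ l ∸ p)
     else (p ∸ 2 ^ l , j , (if (p ∸ 2 ^ l) ≡ᵇ 0 then 1 + j % 2 else 1)))
  else if i ≡ᵇ 0 then
    -- edges (4) (port 3), (3) (port 1 + j mod 2), (1) (port 1 + (j+1) mod 2)
    (if p ≡ᵇ 3 then (1 , π 0 j , 2)
     else if p ≡ᵇ 1 + j % 2 then (suc l , j , 2 ^ l + 0)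
     else (0 , xor1 j , 1 + (xor1 j + 1) % 2))
  else
    -- 1 ≤ i ≤ l: port 1 edge (3); port 2 incoming edge (4) from
    -- v_{i-1}(π_{i-1}(j)) (π_{i-1} is an involution); port 3 edge (4)
    (if p ≡ᵇ 1 then (suc l , j , 2 ^ l + i)
     else if p ≡ᵇ 2 then (i ∸ 1 , π (i ∸ 1) j , 3)
     else (suc i , π i j , 2))

-- Since ports at a node are a bijection
-- onto {1..deg}, a rooted port-labeled tree is represented canonically by
-- the list of its children sorted by the port at the root; each entry is
-- (port at parent , port at child , subtree).  Equality of views is then
-- propositional equality of these canonical forms.

data Tree : Set where
  node : List (ℕ × ℕ × Tree) → Tree

ports : ℕ → List ℕ
ports n = map suc (upTo n)

view : ℕ → ℕ → ℕ → ℕ → Tree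
view l zero i j = node []
view l (suc t) i j =
  node (map (λ p → p , proj₂ (proj₂ (nbr l i j p))
                     , view l t (proj₁ (nbr l i j p)) (proj₁ (proj₂ (nbr l i j p))))
            (ports (deg l i j)))

-- Read at a fixed port, every neighbour map of G_l keeps the level and the
-- returning port and sends indices congruent mod 2^(t+1) to indices
-- congruent mod 2^t: rotations j ↦ j + p mod 2^l and j ↦ j ⊕ 1 respect every
-- congruence mod a power of two, and π_i swaps only the bits i - 1 and i,
-- so it loses at most one low bit of agreement.  By induction on t the view
-- 𝒱_t(v_i(j)) therefore depends only on j mod 2^t, and δ(j₁, j₂) is by
-- construction an exponent with j₁ ≡ j₂ mod 2^δ.
module Submission where

open import Defs
open import Data.Nat
  using (ℕ; zero; suc; _+_; _*_; _∸_; _^_; _%_; _/_; _≤_; _<_; _≡ᵇ_; _<ᵇ_;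
         NonZero; >-nonZero⁻¹; z≤n; s≤s)
open import Data.Nat.Properties
open import Data.Nat.DivMod
open import Data.Nat.Divisibility using (_∣_; divides; ∣-trans; m∣m*n)
open import Data.Nat.Solver using (module +-*-Solver)
open import Data.Bool using (true; false; T)
open import Data.Product using (_×_; _,_)
open import Data.Sum using (_⊎_; inj₁; inj₂; [_,_]′)
open import Data.List.Properties using (map-cong)
open import Relation.Binary.PropositionalEquality
  using (_≡_; refl; sym; trans; cong; cong₂; subst; module ≡-Reasoning)

infix 4 _≡_[mod_]

_≡_[mod_] : ℕ → ℕ → (n : ℕ) → .{{NonZero n}} → Set
a ≡ b [mod n ] = a % n ≡ b % n

module _ {n : ℕ} .{{_ : NonZero n}} where

  %-cong-+ʳ : ∀ {a b} c → a ≡ b [mod n ] → a + c ≡ b + c [mod n ]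
  %-cong-+ʳ {a} {b} c a≡b = begin
    (a + c) % n            ≡⟨ %-distribˡ-+ a c n ⟩
    (a % n + c % n) % n    ≡⟨ cong (λ x → (x + c % n) % n) a≡b ⟩
    (b % n + c % n) % n    ≡⟨ %-distribˡ-+ b c n ⟨
    (b + c) % n            ∎
    where open ≡-Reasoning

  -- Adding c * (n ∸ 1) to a + c gives a + c * n, which is a modulo n.
  %-cancel-+ʳ : ∀ {a b} c → a + c ≡ b + c [mod n ] → a ≡ b [mod n ]
  %-cancel-+ʳ {a} {b} c a+c≡b+c = begin
    a % n                        ≡⟨ [m+kn]%n≡m%n a c n ⟨
    (a + c * n) % n              ≡⟨ cong (_% n) (shift a) ⟩
    (a + c + c * (n ∸ 1)) % n    ≡⟨ %-cong-+ʳ (c * (n ∸ 1)) a+c≡b+c ⟩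
    (b + c + c * (n ∸ 1)) % n    ≡⟨ cong (_% n) (shift b) ⟨
    (b + c * n) % n              ≡⟨ [m+kn]%n≡m%n b c n ⟩
    b % n                        ∎
    where
    open ≡-Reasoning
    shift : ∀ x → x + c * n ≡ x + c + c * (n ∸ 1)
    shift x = begin
      x + c * n                  ≡⟨ cong (λ y → x + c * y) (m+[n∸m]≡n (>-nonZero⁻¹ n)) ⟨
      x + c * (1 + (n ∸ 1))      ≡⟨ cong (x +_) (*-suc c (n ∸ 1)) ⟩
      x + (c + c * (n ∸ 1))      ≡⟨ +-assoc x c _ ⟨
      x + c + c * (n ∸ 1)        ∎

  %-cong-∸ʳ : ∀ {a b c} → c ≤ a → c ≤ b → a ≡ b [mod n ] → a ∸ c ≡ b ∸ c [mod n ]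
  %-cong-∸ʳ {a} {b} {c} c≤a c≤b a≡b = %-cancel-+ʳ c
    (trans (cong (_% n) (m∸n+n≡m c≤a)) (trans a≡b (cong (_% n) (sym (m∸n+n≡m c≤b)))))

  %-cong-∣ : ∀ {m a b} .{{_ : NonZero m}} → m ∣ n → a ≡ b [mod n ] → a ≡ b [mod m ]
  %-cong-∣ {m} {a} {b} m∣n a≡b = begin
    a % m          ≡⟨ m∣n⇒o%n%m≡o%m m n a m∣n ⟨
    a % n % m      ≡⟨ cong (_% m) a≡b ⟩
    b % n % m      ≡⟨ m∣n⇒o%n%m≡o%m m n b m∣n ⟩
    b % m          ∎
    where open ≡-Reasoning

  %-cong-% : ∀ {m a b} .{{_ : NonZero m}} → m ∣ n ⊎ n ∣ m →
             a ≡ b [mod n ] → a % m ≡ b % m [mod n ]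
  %-cong-% {m} (inj₁ m∣n) a≡b = cong (_% n) (%-cong-∣ m∣n a≡b)
  %-cong-% {m} {a} {b} (inj₂ n∣m) a≡b =
    trans (m∣n⇒o%n%m≡o%m n m a n∣m) (trans a≡b (sym (m∣n⇒o%n%m≡o%m n m b n∣m)))

^-∣-mono : ∀ m {s t} → s ≤ t → m ^ s ∣ m ^ t
^-∣-mono m {s} {t} s≤t = divides (m ^ (t ∸ s))
  (trans (cong (m ^_) (sym (m∸n+n≡m s≤t))) (^-distribˡ-+-* m (t ∸ s) s))

2^-∣-total : ∀ s t → 2 ^ s ∣ 2 ^ t ⊎ 2 ^ t ∣ 2 ^ s
2^-∣-total s t with ≤-total s t
... | inj₁ s≤t = inj₁ (^-∣-mono 2 s≤t)
... | inj₂ t≤s = inj₂ (^-∣-mono 2 t≤s)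

-- NonZero proofs for powers of two are passed explicitly, as in Defs: an instance
-- ∀ {t} → NonZero (2 ^ t) would make every search for NonZero 2 block on 2 ^ ?t = 2.
infixl 7 _mod2^_
infix 4 _≡_[mod2^_]

_mod2^_ : ℕ → ℕ → ℕ
j mod2^ t = _%_ j (2 ^ t) {{m^n≢0 2 t}}

_≡_[mod2^_] : ℕ → ℕ → ℕ → Set
a ≡ b [mod2^ t ] = a mod2^ t ≡ b mod2^ t

≡mod2^-weaken : ∀ {s t a b} → s ≤ t → a ≡ b [mod2^ t ] → a ≡ b [mod2^ s ]
≡mod2^-weaken {s} {t} s≤t = %-cong-∣ (^-∣-mono 2 s≤t)
  where instance 2^t≢0 = m^n≢0 2 t
                 2^s≢0 = m^n≢0 2 s

≡mod2^-pred : ∀ {t a b} → a ≡ b [mod2^ suc t ] → a ≡ b [mod2^ t ]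
≡mod2^-pred {t} = ≡mod2^-weaken (n≤1+n t)

≡mod2^suc⇒%2≡ : ∀ {t a b} → a ≡ b [mod2^ suc t ] → a % 2 ≡ b % 2
≡mod2^suc⇒%2≡ {t} = ≡mod2^-weaken {1} {suc t} (s≤s z≤n)

b≡mod2^suc/2^ : ∀ k j → b k j ≡ _/_ (j mod2^ suc k) (2 ^ k) {{m^n≢0 2 k}}
b≡mod2^suc/2^ k j = sym (m%[n*o]/o≡m/o%n j 2 (2 ^ k))
  where instance 2^k≢0   = m^n≢0 2 k
                 2^k+1≢0 = m^n≢0 2 (suc k)

mod2^suc-split : ∀ k j → j mod2^ suc k ≡ j mod2^ k + 2 ^ k * b k j
mod2^suc-split k j = begin
  r                              ≡⟨ m≡m%n+[m/n]*n r (2 ^ k) ⟩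
  r % 2 ^ k + r / 2 ^ k * 2 ^ k  ≡⟨ cong₂ _+_ (m∣n⇒o%n%m≡o%m (2 ^ k) (2 ^ suc k) j (^-∣-mono 2 (n≤1+n k)))
                                             (cong (_* 2 ^ k) (sym (b≡mod2^suc/2^ k j))) ⟩
  j % 2 ^ k + b k j * 2 ^ k      ≡⟨ cong (j % 2 ^ k +_) (*-comm (b k j) (2 ^ k)) ⟩
  j % 2 ^ k + 2 ^ k * b k j      ∎
  where
  open ≡-Reasoning
  instance 2^k≢0   = m^n≢0 2 k
           2^k+1≢0 = m^n≢0 2 (suc k)
  r = j % 2 ^ suc k

b-cong : ∀ {k s j₁ j₂} → k < s → j₁ ≡ j₂ [mod2^ s ] → b k j₁ ≡ b k j₂
b-cong {k} {s} {j₁} {j₂} k<s j₁≡j₂ = begin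
  b k j₁                      ≡⟨ b≡mod2^suc/2^ k j₁ ⟩
  j₁ mod2^ suc k / 2 ^ k      ≡⟨ cong (_/ 2 ^ k) (≡mod2^-weaken k<s j₁≡j₂) ⟩
  j₂ mod2^ suc k / 2 ^ k      ≡⟨ b≡mod2^suc/2^ k j₂ ⟨
  b k j₂                      ∎
  where
  open ≡-Reasoning
  instance 2^k≢0 = m^n≢0 2 k

two-bits≤ : ∀ k j → 2 ^ suc k * b (suc k) j + 2 ^ k * b k j ≤ j
two-bits≤ k j = begin
  A + B                  ≡⟨ +-comm A B ⟩
  B + A                  ≤⟨ +-monoˡ-≤ A (m≤n+m B (j mod2^ k)) ⟩
  j mod2^ k + B + A      ≡⟨ cong (_+ A) (mod2^suc-split k j) ⟨
  j mod2^ suc k + A      ≡⟨ mod2^suc-split (suc k) j ⟨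
  j mod2^ suc (suc k)    ≤⟨ m%n≤m j (2 ^ suc (suc k)) {{m^n≢0 2 (suc (suc k))}} ⟩
  j                      ∎
  where
  open ≤-Reasoning
  A = 2 ^ suc k * b (suc k) j
  B = 2 ^ k * b k j

-- π_{k+1} trades 2^(k+1) b_{k+1} + 2^k b_k for 2^(k+1) b_k + 2^k b_{k+1}; its
-- truncated subtractions are exact by two-bits≤.
π-suc-+ : ∀ k j → π (suc k) j + 2 ^ k * b (suc k) j ≡ j + 2 ^ k * b k j
π-suc-+ k j = begin
  j ∸ A ∸ B + C + D + D     ≡⟨ cong (λ x → x + C + D + D) (∸-+-assoc j A B) ⟩
  j ∸ (A + B) + C + D + D   ≡⟨ solve 4 (λ e x bₖ₊₁ bₖ → e :+ (con 2 :* x) :* bₖ :+ x :* bₖ₊₁ :+ x :* bₖ₊₁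
                                             := e :+ ((con 2 :* x) :* bₖ₊₁ :+ x :* bₖ) :+ x :* bₖ)
                                  refl (j ∸ (A + B)) (2 ^ k) (b (suc k) j) (b k j) ⟩
  j ∸ (A + B) + (A + B) + B ≡⟨ cong (_+ B) (m∸n+n≡m (two-bits≤ k j)) ⟩
  j + B                     ∎
  where
  open ≡-Reasoning
  open +-*-Solver
  A = 2 ^ suc k * b (suc k) j
  B = 2 ^ k * b k j
  C = 2 ^ suc k * b k j
  D = 2 ^ k * b (suc k) j

π-suc-≡mod2^-self : ∀ {k t} j → t ≤ k → π (suc k) j ≡ j [mod2^ t ]
π-suc-≡mod2^-self {k} {t} j t≤k = begin
  π (suc k) j % 2 ^ t                         ≡⟨ %-remove-+ʳ _ (2^t∣2^k* (b (suc k) j)) ⟨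
  (π (suc k) j + 2 ^ k * b (suc k) j) % 2 ^ t ≡⟨ cong (_% 2 ^ t) (π-suc-+ k j) ⟩
  (j + 2 ^ k * b k j) % 2 ^ t                 ≡⟨ %-remove-+ʳ j (2^t∣2^k* (b k j)) ⟩
  j % 2 ^ t                                   ∎
  where
  open ≡-Reasoning
  instance 2^t≢0 = m^n≢0 2 t
  2^t∣2^k* : ∀ x → 2 ^ t ∣ 2 ^ k * x
  2^t∣2^k* x = ∣-trans (^-∣-mono 2 t≤k) (m∣m*n x)

π-suc-cong-low : ∀ {k t j₁ j₂} → j₁ ≡ j₂ [mod2^ t ] → t ≤ k →
                 π (suc k) j₁ ≡ π (suc k) j₂ [mod2^ t ]
π-suc-cong-low {j₁ = j₁} {j₂} j₁≡j₂ t≤k =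
  trans (π-suc-≡mod2^-self j₁ t≤k) (trans j₁≡j₂ (sym (π-suc-≡mod2^-self j₂ t≤k)))

-- Both swapped bits lie below t + 1, so they agree and π-suc-+ can be cancelled.
π-suc-cong-high : ∀ {k t j₁ j₂} → j₁ ≡ j₂ [mod2^ suc t ] → k < t →
                  π (suc k) j₁ ≡ π (suc k) j₂ [mod2^ t ]
π-suc-cong-high {k} {t} {j₁} {j₂} j₁≡j₂ k<t = %-cancel-+ʳ {2 ^ t} (2 ^ k * b (suc k) j₁) (begin
  (π (suc k) j₁ + 2 ^ k * b (suc k) j₁) % 2 ^ t ≡⟨ cong (_% 2 ^ t) (π-suc-+ k j₁) ⟩
  (j₁ + 2 ^ k * b k j₁) % 2 ^ t                 ≡⟨ cong (λ x → (j₁ + 2 ^ k * x) % 2 ^ t) bₖ≡ ⟩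
  (j₁ + 2 ^ k * b k j₂) % 2 ^ t                 ≡⟨ %-cong-+ʳ {2 ^ t} _ (≡mod2^-pred {t} j₁≡j₂) ⟩
  (j₂ + 2 ^ k * b k j₂) % 2 ^ t                 ≡⟨ cong (_% 2 ^ t) (π-suc-+ k j₂) ⟨
  (π (suc k) j₂ + 2 ^ k * b (suc k) j₂) % 2 ^ t ≡⟨ cong (λ x → (π (suc k) j₂ + 2 ^ k * x) % 2 ^ t) bₖ₊₁≡ ⟨
  (π (suc k) j₂ + 2 ^ k * b (suc k) j₁) % 2 ^ t ∎)
  where
  open ≡-Reasoning
  instance 2^t≢0 = m^n≢0 2 t
  bₖ≡ : b k j₁ ≡ b k j₂
  bₖ≡ = b-cong (≤-trans (n≤1+n (suc k)) (s≤s k<t)) j₁≡j₂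
  bₖ₊₁≡ : b (suc k) j₁ ≡ b (suc k) j₂
  bₖ₊₁≡ = b-cong (s≤s k<t) j₁≡j₂

π-cong : ∀ k {t j₁ j₂} → j₁ ≡ j₂ [mod2^ suc t ] → π k j₁ ≡ π k j₂ [mod2^ t ]
π-cong zero    {t} j₁≡j₂ = ≡mod2^-pred {t} j₁≡j₂
π-cong (suc k) {t} j₁≡j₂ =
  [ π-suc-cong-high j₁≡j₂ , π-suc-cong-low (≡mod2^-pred {t} j₁≡j₂) ]′ (<-≤-connex k t)

b0≤ : ∀ j → b 0 j ≤ j
b0≤ j = ≤-trans (m%n≤m (j / 1) 2) (m/n≤m j 1)

xor1-cong : ∀ {t j₁ j₂} → j₁ ≡ j₂ [mod2^ suc t ] → xor1 j₁ ≡ xor1 j₂ [mod2^ suc t ]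
xor1-cong {t} {j₁} {j₂} j₁≡j₂ =
  trans (%-cong-+ʳ {2 ^ suc t} (1 ∸ b 0 j₁)
          (%-cong-∸ʳ (b0≤ j₁) (subst (_≤ j₂) (sym b₁≡b₂) (b0≤ j₂)) j₁≡j₂))
        (cong (λ r → (j₂ ∸ r + (1 ∸ r)) mod2^ suc t) b₁≡b₂)
  where
  instance 2^t+1≢0 = m^n≢0 2 (suc t)
  b₁≡b₂ : b 0 j₁ ≡ b 0 j₂
  b₁≡b₂ = b-cong {s = suc t} (s≤s z≤n) j₁≡j₂

data Matching (t : ℕ) : ℕ × ℕ × ℕ → ℕ × ℕ × ℕ → Set where
  matching : ∀ {i j₁ j₂ q₁ q₂} → j₁ ≡ j₂ [mod2^ t ] → q₁ ≡ q₂ →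
             Matching t (i , j₁ , q₁) (i , j₂ , q₂)

-- The congruences are hypotheses rather than consequences of one congruence
-- mod 2^(t+1): in the with-clauses the goal is normalised and no longer fixes
-- the implicit arguments of the lemmas deriving them.
nbr-match : ∀ l i p {t j₁ j₂} → j₁ ≡ j₂ [mod2^ t ] → j₁ % 2 ≡ j₂ % 2 →
            xor1 j₁ ≡ xor1 j₂ [mod2^ t ] → (xor1 j₁ + 1) % 2 ≡ (xor1 j₂ + 1) % 2 →
            (∀ k → π k j₁ ≡ π k j₂ [mod2^ t ]) →
            Matching t (nbr l i j₁ p) (nbr l i j₂ p)
nbr-match l i p {t} j₁≡j₂ parity xor≡ xor-parity π≡ with i ≡ᵇ suc l
... | true with p <ᵇ 2 ^ l
...   | true  = matching (%-cong-% {{m^n≢0 2 t}} {{m^n≢0 2 l}} (2^-∣-total l t)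
                                 (%-cong-+ʳ {{m^n≢0 2 t}} p j₁≡j₂))
                      refl
...   | false with (p ∸ 2 ^ l) ≡ᵇ 0
...     | true  = matching j₁≡j₂ (cong suc parity)
...     | false = matching j₁≡j₂ refl
nbr-match l i p {t} {j₁} {j₂} j₁≡j₂ parity xor≡ xor-parity π≡ | false with i ≡ᵇ 0
... | true with p ≡ᵇ 3
...   | true  = matching j₁≡j₂ refl
...   | false rewrite parity with p ≡ᵇ 1 + j₂ % 2
...     | true  = matching j₁≡j₂ refl
...     | false = matching xor≡ (cong suc xor-parity)
nbr-match l i p j₁≡j₂ parity xor≡ xor-parity π≡ | false | false with p ≡ᵇ 1
... | true  = matching j₁≡j₂ refl
... | false with p ≡ᵇ 2
...   | true  = matching (π≡ (i ∸ 1)) refl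
...   | false = matching (π≡ i) refl

nbr-cong : ∀ l i p {t j₁ j₂} → j₁ ≡ j₂ [mod2^ suc t ] →
           Matching t (nbr l i j₁ p) (nbr l i j₂ p)
nbr-cong l i p {t} {j₁} {j₂} j₁≡j₂ = nbr-match l i p
  (≡mod2^-pred {t} j₁≡j₂) (≡mod2^suc⇒%2≡ {t} j₁≡j₂)
  (≡mod2^-pred {t} xor≡) (%-cong-+ʳ {2} {xor1 j₁} {xor1 j₂} 1 (≡mod2^suc⇒%2≡ {t} xor≡))
  (λ k → π-cong k {t} j₁≡j₂)
  where
  xor≡ = xor1-cong {t} j₁≡j₂

view-cong : ∀ l t i {j₁ j₂} → j₁ ≡ j₂ [mod2^ t ] → view l t i j₁ ≡ view l t i j₂
view-cong l zero    i j₁≡j₂ = refl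
view-cong l (suc t) i {j₁} {j₂} j₁≡j₂ =
  cong node (map-cong (λ p → child p (nbr-cong l i p j₁≡j₂)) (ports (deg l i j₁)))
  where
  child : ∀ p {x y} → Matching t x y →
          (p , _ , view l t _ _) ≡ (p , _ , view l t _ _)
  child p {i′ , _ , q} (matching j≡j′ refl) = cong (λ v → p , q , v) (view-cong l t i′ j≡j′)

deltaUpTo-cong : ∀ d j₁ j₂ → j₁ ≡ j₂ [mod2^ deltaUpTo d j₁ j₂ ]
deltaUpTo-cong zero    j₁ j₂ = trans (n%1≡0 j₁) (sym (n%1≡0 j₂))
deltaUpTo-cong (suc d) j₁ j₂ with j₁ mod2^ suc d ≡ᵇ j₂ mod2^ suc d in eq
... | true  = ≡ᵇ⇒≡ (j₁ mod2^ suc d) (j₂ mod2^ suc d) (subst T (sym eq) _)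
... | false = deltaUpTo-cong d j₁ j₂

lemma3p3 : (l i j₁ j₂ : ℕ) → 1 ≤ l → i ≤ l + 1 → j₁ < 2 ^ l → j₂ < 2 ^ l →
           0 < δ l j₁ j₂ →
           view l (δ l j₁ j₂) i j₁ ≡ view l (δ l j₁ j₂) i j₂
lemma3p3 l i j₁ j₂ _ _ _ _ _ = view-cong l (δ l j₁ j₂) i (deltaUpTo-cong l j₁ j₂)
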